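{- Let $M$ be a binary matroid on a finite set $E$, $X\subseteq E$ with $e\in X$, and $M^e_X$ the es-splitting matroid. Let $A'\subseteq E\cup\{a,\gamma\}$ and suppose $A=A'\setminus\{a,\gamma\}$ is a flat of $M$. Then $A'$ is a flat of $M^e_X$ if one of the following conditions is satisfied: (1) $A'=A$, $A\cup\{e\}$ contains no OX-circuit of $M$, and $\mathcal F(A)=\emptyset$; (2) $A'=A$ and $cl(A)$ contains no OX-circuit of $M$; (3) $A'=A\cup\{a\}$ and $e\notin cl(A)$; (4) $A'=A\cup\{\gamma\}$, $e\notin cl(A)$, $cl(A)$ contains an OX-circuit of $M$ but $A$ contains no OX-circuit of $M$, $\mathcal F(A)=\emptyset$ and $\mathcal T(A)=\emptyset$; (5) $A'=A\cup\{\gamma\}$, $cl(A)$ contains no OX-circuit of $M$, $e\notin cl(A)$ and $\mathcal T(A)=\emptyset$; (6) $A'=A\cup\{a,\gamma\}$ and $e\in A$.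
   Context: Let $a,\gamma\notin E$ be two new elements. Let $A_M$ be a matrix over GF(2) representing $M$ (columns indexed by $E$). Form $A^e_X$ from $A_M$ by appending a new row $\delta_X$ whose entries are $1$ in the columns of elements of $X$ and $0$ elsewhere, and then appending two new columns: a column $a$ which is $0$ everywhere except for a $1$ in the new last row, and a column $\gamma$ which is the GF(2)-sum of the columns $a$ and $e$. The es-splitting matroid $M^e_X$ is the vector matroid of $A^e_X$, with ground set $E\cup\{a,\gamma\}$. $cl$ denotes the closure operator of $M$; a flat of a matroid is a set equal to its own closure. An OX-circuit of $M$ is a circuit of $M$ containing an odd number of elements of $X$; a set "contains an OX-circuit" if some OX-circuit of $M$ is a subset of it. For $A\subseteq E$: $\mathcal F(A)=\{x\in cl(A)\setminus A:$ there is an OX-circuit $C$ of $M$ with $x\in C\subseteq cl(A)\}$, and $\mathcal T(A)=\{x\in E\setminus A: x\neq e$ and there is an OX-circuit $C$ of $M$ with $x,e\in C$ and $C\subseteq A\cup\{e,x\}\}$. -}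

module Defs where

open import Data.Nat using (ℕ; zero; suc; _%_)
open import Data.Bool using (Bool; true; false; _∧_; _xor_)
open import Data.Fin using (Fin; zero; suc)
open import Data.Vec using (Vec; []; _∷_; lookup)
open import Data.Fin.Subset using (Subset; _∈_; _∉_; _⊆_; _⊂_; _∩_; _∪_; ⁅_⁆; ∣_∣; Nonempty)
open import Data.Product using (Σ; _×_; ∃)
open import Relation.Nullary using (¬_)
open import Relation.Binary.PropositionalEquality using (_≡_; _≢_)

-- A matrix over GF(2) (entries in Bool, addition = xor, multiplication = ∧)
-- with m rows and n columns; columns are indexed by Fin n.
Matrix : ℕ → ℕ → Set
Matrix m n = Fin m → Fin n → Bool

colSum : ∀ {m n} → Matrix m n → Subset n → Fin m → Bool
colSum {n = zero}  A []      r = false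
colSum {n = suc n} A (b ∷ S) r = (b ∧ A r zero) xor colSum (λ r' j → A r' (suc j)) S r

Dependent : ∀ {m n} → Matrix m n → Subset n → Set
Dependent A S = ∃ λ T → T ⊆ S × Nonempty T × (∀ r → colSum A T r ≡ false)

Circuit : ∀ {m n} → Matrix m n → Subset n → Set
Circuit A C = Dependent A C × (∀ T → T ⊂ C → ¬ Dependent A T)

_∈cl[_]_ : ∀ {m n} → Fin n → Matrix m n → Subset n → Set
x ∈cl[ A ] S = ∃ λ T → T ⊆ S × (∀ r → colSum A T r ≡ A r x)

-- flat: a set equal to its closure (S ⊆ cl(S) always holds)
Flat : ∀ {m n} → Matrix m n → Subset n → Set
Flat A S = ∀ x → x ∈cl[ A ] S → x ∈ S

OXCircuit : ∀ {m n} → Matrix m n → Subset n → Subset n → Set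
OXCircuit A X C = Circuit A C × ∣ C ∩ X ∣ % 2 ≡ 1

ContainsOX : ∀ {m n} → Matrix m n → Subset n → Subset n → Set
ContainsOX A X S = ∃ λ C → OXCircuit A X C × C ⊆ S

ClContainsOX : ∀ {m n} → Matrix m n → Subset n → Subset n → Set
ClContainsOX A X S = ∃ λ C → OXCircuit A X C × (∀ y → y ∈ C → y ∈cl[ A ] S)

In𝓕 : ∀ {m n} → Matrix m n → Subset n → Subset n → Fin n → Set
In𝓕 A X S x = x ∈cl[ A ] S × x ∉ S ×
  (∃ λ C → OXCircuit A X C × x ∈ C × (∀ y → y ∈ C → y ∈cl[ A ] S))

𝓕Empty : ∀ {m n} → Matrix m n → Subset n → Subset n → Set
𝓕Empty A X S = ∀ x → ¬ In𝓕 A X S x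

In𝓣 : ∀ {m n} → Matrix m n → Subset n → Fin n → Subset n → Fin n → Set
In𝓣 A X e S x = x ∉ S × x ≢ e ×
  (∃ λ C → OXCircuit A X C × x ∈ C × e ∈ C × C ⊆ (S ∪ ⁅ e ⁆ ∪ ⁅ x ⁆))

𝓣Empty : ∀ {m n} → Matrix m n → Subset n → Fin n → Subset n → Set
𝓣Empty A X e S = ∀ x → ¬ In𝓣 A X e S x

-- Convention: the new row δ_X is row index zero (the old row r becomes suc r);
-- the new columns are a = index zero, γ = index suc zero, and the old
-- column i ∈ E becomes index suc (suc i). (Reordering rows/columns does
-- not change the vector matroid.)

δ : ∀ {n} → Subset n → Fin n → Bool
δ X i = lookup X i

esMatrix : ∀ {m n} → Matrix m n → Subset n → Fin n → Matrix (suc m) (suc (suc n))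
esMatrix A X e zero    zero             = true
esMatrix A X e (suc r) zero             = false
-- column γ = column a + column e
esMatrix A X e zero    (suc zero)       = true xor δ X e
esMatrix A X e (suc r) (suc zero)       = false xor A r e
esMatrix A X e zero    (suc (suc i))    = δ X i
esMatrix A X e (suc r) (suc (suc i))    = A r i

aₑ : ∀ {n} → Fin (suc (suc n))
aₑ = zero

γₑ : ∀ {n} → Fin (suc (suc n))
γₑ = suc zero

ground : ∀ {n} → Subset (suc (suc n)) → Subset n
ground (_ ∷ _ ∷ S) = S

-- Since e ∈ X, the column γ = a + e of A^e_X is (0, e), so a column x of A^e_X is spanned by
-- A' exactly when some T ⊆ A satisfies: the columns of T (plus e if γ is used) sum to x in M,
-- and the δ-row (plus 1 if a is used) matches. For x ∉ A' every such representation yields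
-- either x ∈ cl(A) = A, or e ∈ cl(A), or a GF(2)-cycle of M inside A (or inside A ∪ {e, x})
-- meeting X oddly. An odd cycle contains an OX-circuit: a cycle that is not a circuit is the
-- disjoint union of two smaller cycles, one of which again meets X oddly. The hypotheses of
-- each case rule all of these out; in the γ-case an OX-circuit through e and x is excluded by
-- 𝓣(A) = ∅, and one through only one of them would put that element in cl(A).

module Submission where

open import Defs
open import Algebra.Bundles using (CommutativeRing)
open import Data.Bool using (Bool; true; false; _∧_; _xor_; not; if_then_else_) renaming (_≟_ to _≟ᵇ_)
open import Data.Bool.Properties
  using (∧-identityʳ; ∧-zeroʳ; ∧-distribʳ-xor; xor-same; xor-identityʳ; xor-∧-commutativeRing)
open import Algebra.Properties.CommutativeSemigroup
  (CommutativeRing.+-commutativeSemigroup xor-∧-commutativeRing) using (interchange; x∙yz≈y∙xz)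
open import Data.Empty as Empty using ()
open import Data.Fin using (Fin; zero; suc)
open import Data.Fin.Properties using (all?) renaming (_≟_ to _≟ᶠ_)
open import Data.Fin.Subset using (Subset; _∈_; _∉_; _⊆_; _⊂_; _∩_; _∪_; ⁅_⁆; ∣_∣; Nonempty; ⊥)
open import Data.Fin.Subset.Properties
  using (_∈?_; _⊂?_; nonempty?; anySubset?; drop-there; drop-∷-⊆; ⊆-refl; ⊆-trans; ⊆-⊂-trans; ⊆-antisym;
         p⊆p∪q; p⊂q⇒p⊆q; p⊂q⇒∣p∣<∣q∣; x∈⁅x⁆; x∈⁅y⁆⇒x≡y; x∈p∪q⁺; x∈p∪q⁻)
open import Data.Nat using (ℕ; zero; suc; _%_)
open import Data.Nat.Induction using (<-wellFounded)
open import Data.Product using (∃; _×_; _,_; proj₁)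
open import Data.Sum using (_⊎_; inj₁; inj₂)
open import Data.Vec using ([]; _∷_; lookup; zipWith; here; there)
open import Data.Vec.Properties using ([]=⇒lookup)
open import Function using (_∘_)
open import Induction.WellFounded using (Acc; acc; WellFounded; module Subrelation)
open import Relation.Binary.Construct.On using () renaming (wellFounded to on-wellFounded)
open import Relation.Binary.PropositionalEquality using (_≡_; _≢_; refl; sym; trans; cong; cong₂; subst; module ≡-Reasoning)
open import Relation.Nullary using (¬_; Dec; yes; no; contradiction)
open import Relation.Nullary.Decidable using (_×-dec_)

open ≡-Reasoning

private
  variable
    m n : ℕ
    AM : Matrix m n
    S T C X : Subset n
    e i x y : Fin n
    ba bg ta tg : Bool

infixr 6 _⊕_

_⊕_ : Subset n → Subset n → Subset n
_⊕_ = zipWith _xor_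

x∈p⊕q⁻ : ∀ (p q : Subset n) → x ∈ p ⊕ q → (x ∈ p × x ∉ q) ⊎ (x ∉ p × x ∈ q)
x∈p⊕q⁻ (true  ∷ p) (false ∷ q) here = inj₁ (here , λ ())
x∈p⊕q⁻ (false ∷ p) (true  ∷ q) here = inj₂ ((λ ()) , here)
x∈p⊕q⁻ (s ∷ p) (t ∷ q) (there x∈p⊕q) with x∈p⊕q⁻ p q x∈p⊕q
... | inj₁ (x∈p , x∉q) = inj₁ (there x∈p , x∉q ∘ drop-there)
... | inj₂ (x∉p , x∈q) = inj₂ (x∉p ∘ drop-there , there x∈q)

⊕-⊆ : ∀ {p q : Subset n} → p ⊆ S → q ⊆ S → p ⊕ q ⊆ S
⊕-⊆ {p = p} {q} p⊆S q⊆S x∈p⊕q with x∈p⊕q⁻ p q x∈p⊕q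
... | inj₁ (x∈p , _) = p⊆S x∈p
... | inj₂ (_ , x∈q) = q⊆S x∈q

⊕-⊂ : ∀ {p q : Subset n} → q ⊂ p → Nonempty q → p ⊕ q ⊂ p
⊕-⊂ {p = p} {q} (q⊆p , _) (y , y∈q) = p⊕q⊆p , y , q⊆p y∈q , y∉p⊕q
  where
  p⊕q⊆p : p ⊕ q ⊆ p
  p⊕q⊆p = ⊕-⊆ ⊆-refl q⊆p
  y∉p⊕q : y ∉ p ⊕ q
  y∉p⊕q y∈p⊕q with x∈p⊕q⁻ p q y∈p⊕q
  ... | inj₁ (_ , y∉q) = y∉q y∈q
  ... | inj₂ (y∉p , _) = y∉p (q⊆p y∈q)

⁅⁆⊆ : x ∈ S → ⁅ x ⁆ ⊆ S
⁅⁆⊆ {x = x} x∈S y∈⁅x⁆ = subst (_∈ _) (sym (x∈⁅y⁆⇒x≡y x y∈⁅x⁆)) x∈S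

∈∧∉⇒≢ : x ∈ S → y ∉ S → x ≢ y
∈∧∉⇒≢ x∈S y∉S refl = y∉S x∈S

rowSum : (Fin n → Bool) → Subset n → Bool
rowSum f []      = false
rowSum f (b ∷ T) = (b ∧ f zero) xor rowSum (f ∘ suc) T

colSum≡rowSum : ∀ (A : Matrix m n) T r → colSum A T r ≡ rowSum (A r) T
colSum≡rowSum A []      r = refl
colSum≡rowSum A (b ∷ T) r = cong ((b ∧ A r zero) xor_) (colSum≡rowSum (λ r′ j → A r′ (suc j)) T r)

rowSum-⊕ : ∀ (f : Fin n → Bool) p q → rowSum f (p ⊕ q) ≡ rowSum f p xor rowSum f q
rowSum-⊕ f []      []      = refl
rowSum-⊕ f (s ∷ p) (t ∷ q) = begin
  ((s xor t) ∧ f zero) xor rowSum (f ∘ suc) (p ⊕ q)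
    ≡⟨ cong₂ _xor_ (∧-distribʳ-xor (f zero) s t) (rowSum-⊕ (f ∘ suc) p q) ⟩
  ((s ∧ f zero) xor (t ∧ f zero)) xor (rowSum (f ∘ suc) p xor rowSum (f ∘ suc) q)
    ≡⟨ interchange (s ∧ f zero) (t ∧ f zero) (rowSum (f ∘ suc) p) (rowSum (f ∘ suc) q) ⟩
  ((s ∧ f zero) xor rowSum (f ∘ suc) p) xor ((t ∧ f zero) xor rowSum (f ∘ suc) q) ∎

rowSum-⊥ : ∀ (f : Fin n → Bool) → rowSum f ⊥ ≡ false
rowSum-⊥ {zero}  f = refl
rowSum-⊥ {suc n} f = rowSum-⊥ (f ∘ suc)

rowSum-⁅⁆ : ∀ (f : Fin n → Bool) i → rowSum f ⁅ i ⁆ ≡ f i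
rowSum-⁅⁆ f zero    = trans (cong (f zero xor_) (rowSum-⊥ (f ∘ suc))) (xor-identityʳ (f zero))
rowSum-⁅⁆ f (suc i) = rowSum-⁅⁆ (f ∘ suc) i

rowSum-⁅⁆⊕ : ∀ (f : Fin n → Bool) i T → rowSum f (⁅ i ⁆ ⊕ T) ≡ f i xor rowSum f T
rowSum-⁅⁆⊕ f i T = trans (rowSum-⊕ f ⁅ i ⁆ T) (cong (_xor rowSum f T) (rowSum-⁅⁆ f i))

rowSum≡true⇒Nonempty : ∀ (f : Fin n → Bool) T → rowSum f T ≡ true → Nonempty T
rowSum≡true⇒Nonempty f (true  ∷ T) _ = zero , here
rowSum≡true⇒Nonempty f (false ∷ T) sum≡true with rowSum≡true⇒Nonempty (f ∘ suc) T sum≡true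
... | x , x∈T = suc x , there x∈T

xor≡false⇒≡ : ∀ a b → a xor b ≡ false → b ≡ a
xor≡false⇒≡ false b b≡false = b≡false
xor≡false⇒≡ true  true  _ = refl

bit : Bool → ℕ
bit b = if b then 1 else 0

%2-suc : ∀ k b → k % 2 ≡ bit b → suc k % 2 ≡ bit (not b)
%2-suc 0             false _ = refl
%2-suc 1             true  _ = refl
%2-suc (suc (suc k)) b     k%2≡b = %2-suc k b k%2≡b

∣∩∣%2≡bit-rowSum : ∀ (C X : Subset n) → ∣ C ∩ X ∣ % 2 ≡ bit (rowSum (lookup X) C)
∣∩∣%2≡bit-rowSum []          []          = refl
∣∩∣%2≡bit-rowSum (true  ∷ C) (true  ∷ X) = %2-suc ∣ C ∩ X ∣ (rowSum (lookup X) C) (∣∩∣%2≡bit-rowSum C X)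
∣∩∣%2≡bit-rowSum (true  ∷ C) (false ∷ X) = ∣∩∣%2≡bit-rowSum C X
∣∩∣%2≡bit-rowSum (false ∷ C) (true  ∷ X) = ∣∩∣%2≡bit-rowSum C X
∣∩∣%2≡bit-rowSum (false ∷ C) (false ∷ X) = ∣∩∣%2≡bit-rowSum C X

Cycle : Matrix m n → Subset n → Set
Cycle A T = ∀ r → rowSum (A r) T ≡ false

SumsTo : Matrix m n → Subset n → Fin n → Set
SumsTo A T i = ∀ r → rowSum (A r) T ≡ A r i

MeetsOddly : Subset n → Subset n → Set
MeetsOddly X T = rowSum (lookup X) T ≡ true

sumsTo⇒∈cl : T ⊆ S → SumsTo AM T i → i ∈cl[ AM ] S
sumsTo⇒∈cl {T = T} {AM = AM} T⊆S sum = T , T⊆S , λ r → trans (colSum≡rowSum AM T r) (sum r)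

∈⇒∈cl : i ∈ S → i ∈cl[ AM ] S
∈⇒∈cl {i = i} {AM = AM} i∈S = sumsTo⇒∈cl (⁅⁆⊆ i∈S) (λ r → rowSum-⁅⁆ (AM r) i)

cycle⇒∈cl : Cycle AM C → y ∈ C → (∀ {x} → x ∈ C → x ≢ y → x ∈ S) → y ∈cl[ AM ] S
cycle⇒∈cl {AM = AM} {C = C} {y = y} {S = S} cyc y∈C others = sumsTo⇒∈cl C⊕y⊆S sum
  where
  C⊕y⊆S : C ⊕ ⁅ y ⁆ ⊆ S
  C⊕y⊆S x∈ with x∈p⊕q⁻ C ⁅ y ⁆ x∈
  ... | inj₁ (x∈C , x∉⁅y⁆) = others x∈C (λ { refl → x∉⁅y⁆ (x∈⁅x⁆ y) })
  ... | inj₂ (y∉C , x∈⁅y⁆) = contradiction (subst (_∈ C) (sym (x∈⁅y⁆⇒x≡y y x∈⁅y⁆)) y∈C) y∉C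
  sum : SumsTo AM (C ⊕ ⁅ y ⁆) y
  sum r = trans (rowSum-⊕ (AM r) C ⁅ y ⁆) (cong₂ _xor_ (cyc r) (rowSum-⁅⁆ (AM r) y))

circuit⇒cycle : Circuit AM C → Cycle AM C
circuit⇒cycle {AM = AM} {C = C} ((T , T⊆C , T≠∅ , T-zero) , minimal) r =
  trans (sym (colSum≡rowSum AM C r)) (subst (λ U → colSum AM U r ≡ false) T≡C (T-zero r))
  where
  C⊆T : C ⊆ T
  C⊆T {x} x∈C with x ∈? T
  ... | yes x∈T = x∈T
  ... | no  x∉T = Empty.⊥-elim (minimal T (T⊆C , x , x∈C , x∉T) (T , ⊆-refl , T≠∅ , T-zero))
  T≡C : T ≡ C
  T≡C = ⊆-antisym T⊆C C⊆T

cycle⇒circuit⊎smaller : Cycle AM T → Nonempty T →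
  Circuit AM T ⊎ ∃ λ U → U ⊂ T × Nonempty U × Cycle AM U
cycle⇒circuit⊎smaller {AM = AM} {T = T} cyc T≠∅ with anySubset? smaller?
  where
  smaller? : ∀ U → Dec (U ⊂ T × Nonempty U × (∀ r → colSum AM U r ≡ false))
  smaller? U = (U ⊂? T) ×-dec (nonempty? U ×-dec all? (λ r → colSum AM U r ≟ᵇ false))
... | yes (U , U⊂T , U≠∅ , U-zero) = inj₂ (U , U⊂T , U≠∅ , λ r → trans (sym (colSum≡rowSum AM U r)) (U-zero r))
... | no  none = inj₁ ((T , ⊆-refl , T≠∅ , λ r → trans (colSum≡rowSum AM T r) (cyc r)) , minimal)
  where
  minimal : ∀ T′ → T′ ⊂ T → ¬ Dependent AM T′
  minimal T′ T′⊂T (U , U⊆T′ , U≠∅ , U-zero) = none (U , ⊆-⊂-trans U⊆T′ T′⊂T , U≠∅ , U-zero)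

⊂-wellFounded : WellFounded (_⊂_ {n})
⊂-wellFounded = Subrelation.wellFounded p⊂q⇒∣p∣<∣q∣ (on-wellFounded ∣_∣ <-wellFounded)

ContainsOX-mono : S ⊆ T → ContainsOX AM X S → ContainsOX AM X T
ContainsOX-mono S⊆T (C , oxC , C⊆S) = C , oxC , ⊆-trans C⊆S S⊆T

-- Strong induction on T: a cycle that is not a circuit contains a smaller nonempty cycle U,
-- and one of U and T ⊕ U (both cycles smaller than T) again meets X oddly.
odd-cycle⇒ContainsOX : Cycle AM T → MeetsOddly X T → ContainsOX AM X T
odd-cycle⇒ContainsOX {T = T} = go (⊂-wellFounded T)
  where
  go : ∀ {AM : Matrix m n} {X T} → Acc _⊂_ T → Cycle AM T → MeetsOddly X T → ContainsOX AM X T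
  go {AM = AM} {X} {T} (acc smaller) cyc odd
    with cycle⇒circuit⊎smaller cyc (rowSum≡true⇒Nonempty (lookup X) T odd)
  ... | inj₁ circuit = T , (circuit , trans (∣∩∣%2≡bit-rowSum T X) (cong bit odd)) , ⊆-refl
  ... | inj₂ (U , U⊂T , U≠∅ , cycU) with rowSum (lookup X) U in oddU
  ...   | true  = ContainsOX-mono (p⊂q⇒p⊆q U⊂T) (go (smaller U⊂T) cycU oddU)
  ...   | false = ContainsOX-mono (p⊂q⇒p⊆q T⊕U⊂T) (go (smaller T⊕U⊂T) cycT⊕U oddT⊕U)
    where
    T⊕U⊂T : T ⊕ U ⊂ T
    T⊕U⊂T = ⊕-⊂ U⊂T U≠∅
    cycT⊕U : Cycle AM (T ⊕ U)
    cycT⊕U r = trans (rowSum-⊕ (AM r) T U) (cong₂ _xor_ (cyc r) (cycU r))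
    oddT⊕U : MeetsOddly X (T ⊕ U)
    oddT⊕U = trans (rowSum-⊕ (lookup X) T U) (cong₂ _xor_ odd oddU)

odd-cycle⇒ContainsOX-⊇ : T ⊆ S → Cycle AM T → MeetsOddly X T → ContainsOX AM X S
odd-cycle⇒ContainsOX-⊇ T⊆S cyc odd = ContainsOX-mono T⊆S (odd-cycle⇒ContainsOX cyc odd)

∈-∪⁅⁆∪⁅⁆-resolve : y ∈ S ∪ ⁅ e ⁆ ∪ ⁅ x ⁆ → y ≢ e → y ≢ x → y ∈ S
∈-∪⁅⁆∪⁅⁆-resolve {S = S} {e = e} {x = x} y∈ y≢e y≢x with x∈p∪q⁻ S _ y∈
... | inj₁ y∈S = y∈S
... | inj₂ y∈⁅e⁆∪⁅x⁆ with x∈p∪q⁻ ⁅ e ⁆ ⁅ x ⁆ y∈⁅e⁆∪⁅x⁆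
...   | inj₁ y∈⁅e⁆ = contradiction (x∈⁅y⁆⇒x≡y e y∈⁅e⁆) y≢e
...   | inj₂ y∈⁅x⁆ = contradiction (x∈⁅y⁆⇒x≡y x y∈⁅x⁆) y≢x

¬ContainsOX-∪⁅e⁆∪⁅x⁆ : Flat AM S → ¬ e ∈cl[ AM ] S → ¬ ContainsOX AM X S → 𝓣Empty AM X e S → x ∉ S →
  ¬ ContainsOX AM X (S ∪ ⁅ e ⁆ ∪ ⁅ x ⁆)
¬ContainsOX-∪⁅e⁆∪⁅x⁆ {AM = AM} {S = S} {e = e} {x = x} flat e∉clS noOX no𝓣 x∉S (C , oxC , C⊆) =
  split (e ∈? C) (x ∈? C)
  where
  cyc : Cycle AM C
  cyc = circuit⇒cycle (proj₁ oxC)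
  resolve : ∀ {y} → y ∈ C → y ≢ e → y ≢ x → y ∈ S
  resolve y∈C = ∈-∪⁅⁆∪⁅⁆-resolve (C⊆ y∈C)
  split : Dec (e ∈ C) → Dec (x ∈ C) → Empty.⊥
  split (yes e∈C) (yes x∈C) with x ≟ᶠ e
  ... | no  x≢e = no𝓣 x (x∉S , x≢e , C , oxC , x∈C , e∈C , C⊆)
  ... | yes refl = e∉clS (cycle⇒∈cl cyc e∈C λ y∈C y≢e → resolve y∈C y≢e y≢e)
  split (yes e∈C) (no x∉C) = e∉clS (cycle⇒∈cl cyc e∈C λ y∈C y≢e → resolve y∈C y≢e (∈∧∉⇒≢ y∈C x∉C))
  split (no e∉C)  (yes x∈C) = x∉S (flat x (cycle⇒∈cl cyc x∈C λ y∈C y≢x → resolve y∈C (∈∧∉⇒≢ y∈C e∉C) y≢x))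
  split (no e∉C)  (no x∉C) = noOX (C , oxC , λ y∈C → resolve y∈C (∈∧∉⇒≢ y∈C e∉C) (∈∧∉⇒≢ y∈C x∉C))

-- The hypotheses on T say that column i of the es-splitting matrix is γ plus the columns of T.
γ-combination⇒∈ : e ∈ X → Flat AM S → ¬ ContainsOX AM X S → ¬ e ∈cl[ AM ] S → 𝓣Empty AM X e S →
  T ⊆ S → (∀ r → AM r e xor rowSum (AM r) T ≡ AM r i) → rowSum (lookup X) T ≡ lookup X i → i ∈ S
γ-combination⇒∈ {e = e} {X = X} {AM = AM} {S = S} {T = T} {i = i} e∈X flat noOX e∉clS no𝓣 T⊆S sum parity
  with i ∈? S
... | yes i∈S = i∈S
... | no  i∉S =
  contradiction (odd-cycle⇒ContainsOX-⊇ ⊆S∪e∪i cyc odd) (¬ContainsOX-∪⁅e⁆∪⁅x⁆ flat e∉clS noOX no𝓣 i∉S)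
  where
  ⊆S∪e∪i : ⁅ e ⁆ ⊕ ⁅ i ⁆ ⊕ T ⊆ S ∪ ⁅ e ⁆ ∪ ⁅ i ⁆
  ⊆S∪e∪i = ⊕-⊆ (⁅⁆⊆ (x∈p∪q⁺ (inj₂ (x∈p∪q⁺ (inj₁ (x∈⁅x⁆ e))))))
           (⊕-⊆ (⁅⁆⊆ (x∈p∪q⁺ (inj₂ (x∈p∪q⁺ (inj₂ (x∈⁅x⁆ i)))))) (⊆-trans T⊆S (p⊆p∪q _)))
  cyc : Cycle AM (⁅ e ⁆ ⊕ ⁅ i ⁆ ⊕ T)
  cyc r = begin
    rowSum (AM r) (⁅ e ⁆ ⊕ ⁅ i ⁆ ⊕ T)              ≡⟨ rowSum-⁅⁆⊕ (AM r) e (⁅ i ⁆ ⊕ T) ⟩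
    AM r e xor rowSum (AM r) (⁅ i ⁆ ⊕ T)           ≡⟨ cong (AM r e xor_) (rowSum-⁅⁆⊕ (AM r) i T) ⟩
    AM r e xor (AM r i xor rowSum (AM r) T)        ≡⟨ x∙yz≈y∙xz (AM r e) (AM r i) (rowSum (AM r) T) ⟩
    AM r i xor (AM r e xor rowSum (AM r) T)        ≡⟨ cong (AM r i xor_) (sum r) ⟩
    AM r i xor AM r i                             ≡⟨ xor-same (AM r i) ⟩
    false                                         ∎
  odd : MeetsOddly X (⁅ e ⁆ ⊕ ⁅ i ⁆ ⊕ T)
  odd = begin
    rowSum (lookup X) (⁅ e ⁆ ⊕ ⁅ i ⁆ ⊕ T)                 ≡⟨ rowSum-⁅⁆⊕ (lookup X) e (⁅ i ⁆ ⊕ T) ⟩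
    lookup X e xor rowSum (lookup X) (⁅ i ⁆ ⊕ T)          ≡⟨ cong₂ _xor_ ([]=⇒lookup e∈X) (rowSum-⁅⁆⊕ (lookup X) i T) ⟩
    true xor (lookup X i xor rowSum (lookup X) T)         ≡⟨ cong (λ b → true xor (lookup X i xor b)) parity ⟩
    true xor (lookup X i xor lookup X i)                  ≡⟨ cong (true xor_) (xor-same (lookup X i)) ⟩
    true                                                  ∎

ContainsOX⇒ClContainsOX : ContainsOX AM X S → ClContainsOX AM X S
ContainsOX⇒ClContainsOX (C , oxC , C⊆S) = C , oxC , λ y y∈C → ∈⇒∈cl (C⊆S y∈C)

module EsSplitting {m n} (AM : Matrix m n) (X : Subset n) (e : Fin n) (e∈X : e ∈ X) where

  ES : Matrix (suc m) (suc (suc n))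
  ES = esMatrix AM X e

  -- γ = a + e vanishes in the new row exactly because e ∈ X.
  γ-top : ES zero γₑ ≡ false
  γ-top = cong (true xor_) ([]=⇒lookup e∈X)

  Combination : Subset (suc (suc n)) → Fin (suc (suc n)) → Set
  Combination T′ x = ∀ r → colSum ES T′ r ≡ ES r x

  top-row : ∀ ta tg T → Combination (ta ∷ tg ∷ T) x → ta xor rowSum (lookup X) T ≡ ES zero x
  top-row {x = x} ta tg T comb = begin
    ta xor rowSum (lookup X) T
      ≡⟨ cong (λ b → ta xor (b xor rowSum (lookup X) T)) (∧-zeroʳ tg) ⟨
    ta xor ((tg ∧ false) xor rowSum (lookup X) T)
      ≡⟨ cong₂ (λ a b → a xor ((tg ∧ b) xor rowSum (lookup X) T)) (∧-identityʳ ta) γ-top ⟨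
    rowSum (ES zero) (ta ∷ tg ∷ T)
      ≡⟨ colSum≡rowSum ES (ta ∷ tg ∷ T) zero ⟨
    colSum ES (ta ∷ tg ∷ T) zero
      ≡⟨ comb zero ⟩
    ES zero x ∎

  lower-rows : ∀ ta tg T → Combination (ta ∷ tg ∷ T) x → ∀ r → (tg ∧ AM r e) xor rowSum (AM r) T ≡ ES (suc r) x
  lower-rows {x = x} ta tg T comb r = begin
    (tg ∧ AM r e) xor rowSum (AM r) T
      ≡⟨ cong (_xor ((tg ∧ AM r e) xor rowSum (AM r) T)) (∧-zeroʳ ta) ⟨
    rowSum (ES (suc r)) (ta ∷ tg ∷ T)
      ≡⟨ colSum≡rowSum ES (ta ∷ tg ∷ T) (suc r) ⟨
    colSum ES (ta ∷ tg ∷ T) (suc r)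
      ≡⟨ comb (suc r) ⟩
    ES (suc r) x ∎

  ⊆-tail₂ : ∀ {P Q : Subset n} → ta ∷ tg ∷ P ⊆ ba ∷ bg ∷ Q → P ⊆ Q
  ⊆-tail₂ = drop-∷-⊆ ∘ drop-∷-⊆

  a∉ : aₑ ∉ false ∷ bg ∷ S
  a∉ ()

  γ∉ : γₑ ∉ ba ∷ false ∷ S
  γ∉ (there ())

  old-column : Flat AM S → ta ∷ false ∷ T ⊆ ba ∷ bg ∷ S → Combination (ta ∷ false ∷ T) (suc (suc i)) →
    suc (suc i) ∈ ba ∷ bg ∷ S
  old-column {ta = ta} {T = T} flat sub comb =
    there (there (flat _ (sumsTo⇒∈cl (⊆-tail₂ sub) (lower-rows ta false T comb))))

  a∉cl : ¬ ContainsOX AM X S → false ∷ false ∷ T ⊆ ba ∷ bg ∷ S → ¬ Combination (false ∷ false ∷ T) aₑ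
  a∉cl {T = T} noOX sub comb =
    noOX (odd-cycle⇒ContainsOX-⊇ (⊆-tail₂ sub) (lower-rows false false T comb) (top-row false false T comb))

  flat-A : Flat AM S → ¬ ContainsOX AM X S → Flat ES (false ∷ false ∷ S)
  flat-A flat noOX x (true ∷ _ ∷ T , sub , _) = contradiction (sub here) a∉
  flat-A flat noOX x (false ∷ true ∷ T , sub , _) = contradiction (sub (there here)) γ∉
  flat-A flat noOX zero (false ∷ false ∷ T , sub , comb) = contradiction comb (a∉cl noOX sub)
  flat-A {S = S} flat noOX (suc zero) (false ∷ false ∷ T , sub , comb) =
    contradiction (odd-cycle⇒ContainsOX-⊇ (⊕-⊆ (⁅⁆⊆ e∈S) T⊆S) cyc odd) noOX
    where
    T⊆S : T ⊆ S
    T⊆S = ⊆-tail₂ sub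
    e∈S : e ∈ S
    e∈S = flat e (sumsTo⇒∈cl T⊆S (lower-rows false false T comb))
    cyc : Cycle AM (⁅ e ⁆ ⊕ T)
    cyc r = trans (rowSum-⁅⁆⊕ (AM r) e T)
                  (trans (cong (AM r e xor_) (lower-rows false false T comb r)) (xor-same (AM r e)))
    odd : MeetsOddly X (⁅ e ⁆ ⊕ T)
    odd = trans (rowSum-⁅⁆⊕ (lookup X) e T)
                (cong₂ _xor_ ([]=⇒lookup e∈X) (trans (top-row false false T comb) γ-top))
  flat-A flat noOX (suc (suc i)) (false ∷ false ∷ T , sub , comb) = old-column flat sub comb

  flat-A∪a : Flat AM S → ¬ e ∈cl[ AM ] S → Flat ES (true ∷ false ∷ S)
  flat-A∪a flat e∉clS zero _ = here
  flat-A∪a flat e∉clS x (_ ∷ true ∷ T , sub , _) = contradiction (sub (there here)) γ∉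
  flat-A∪a flat e∉clS (suc zero) (ta ∷ false ∷ T , sub , comb) =
    contradiction (sumsTo⇒∈cl (⊆-tail₂ sub) (lower-rows ta false T comb)) e∉clS
  flat-A∪a flat e∉clS (suc (suc i)) (_ ∷ false ∷ T , sub , comb) = old-column flat sub comb

  flat-A∪γ : Flat AM S → ¬ ContainsOX AM X S → ¬ e ∈cl[ AM ] S → 𝓣Empty AM X e S → Flat ES (false ∷ true ∷ S)
  flat-A∪γ flat noOX e∉clS no𝓣 x (true ∷ _ ∷ T , sub , _) = contradiction (sub here) a∉
  flat-A∪γ flat noOX e∉clS no𝓣 (suc zero) _ = there here
  flat-A∪γ flat noOX e∉clS no𝓣 zero (false ∷ false ∷ T , sub , comb) = contradiction comb (a∉cl noOX sub)
  flat-A∪γ flat noOX e∉clS no𝓣 zero (false ∷ true ∷ T , sub , comb) =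
    contradiction (sumsTo⇒∈cl (⊆-tail₂ sub) λ r → xor≡false⇒≡ (AM r e) _ (lower-rows false true T comb r)) e∉clS
  flat-A∪γ flat noOX e∉clS no𝓣 (suc (suc i)) (false ∷ false ∷ T , sub , comb) = old-column flat sub comb
  flat-A∪γ flat noOX e∉clS no𝓣 (suc (suc i)) (false ∷ true ∷ T , sub , comb) =
    there (there (γ-combination⇒∈ e∈X flat noOX e∉clS no𝓣 (⊆-tail₂ sub)
                    (lower-rows false true T comb) (top-row false true T comb)))

  flat-A∪aγ : Flat AM S → e ∈ S → Flat ES (true ∷ true ∷ S)
  flat-A∪aγ flat e∈S zero _ = here
  flat-A∪aγ flat e∈S (suc zero) _ = there here
  flat-A∪aγ flat e∈S (suc (suc i)) (_ ∷ false ∷ T , sub , comb) = old-column flat sub comb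
  flat-A∪aγ flat e∈S (suc (suc i)) (ta ∷ true ∷ T , sub , comb) =
    there (there (flat i (sumsTo⇒∈cl (⊕-⊆ (⁅⁆⊆ e∈S) (⊆-tail₂ sub)) λ r →
      trans (rowSum-⁅⁆⊕ (AM r) e T) (lower-rows ta true T comb r))))

theorem4p1 : ∀ {m n} (AM : Matrix m n) (X : Subset n) (e : Fin n) → e ∈ X →
    (A' : Subset (suc (suc n))) →
    Flat AM (ground A') →
    ( (A' ≡ false ∷ false ∷ ground A' × ¬ ContainsOX AM X (ground A' ∪ ⁅ e ⁆) × 𝓕Empty AM X (ground A'))
    ⊎ (A' ≡ false ∷ false ∷ ground A' × ¬ ClContainsOX AM X (ground A'))
    ⊎ (A' ≡ true ∷ false ∷ ground A' × ¬ (e ∈cl[ AM ] ground A'))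
    ⊎ (A' ≡ false ∷ true ∷ ground A' × ¬ (e ∈cl[ AM ] ground A') × ClContainsOX AM X (ground A')
        × ¬ ContainsOX AM X (ground A') × 𝓕Empty AM X (ground A') × 𝓣Empty AM X e (ground A'))
    ⊎ (A' ≡ false ∷ true ∷ ground A' × ¬ ClContainsOX AM X (ground A') × ¬ (e ∈cl[ AM ] ground A')
        × 𝓣Empty AM X e (ground A'))
    ⊎ (A' ≡ true ∷ true ∷ ground A' × e ∈ ground A') ) →
    Flat (esMatrix AM X e) A'
theorem4p1 AM X e e∈X (_ ∷ _ ∷ S) flat = λ
  { (inj₁ (refl , noOX∪e , _)) → flat-A flat (noOX∪e ∘ ContainsOX-mono (p⊆p∪q ⁅ e ⁆))
  ; (inj₂ (inj₁ (refl , noClOX))) → flat-A flat (noClOX ∘ ContainsOX⇒ClContainsOX)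
  ; (inj₂ (inj₂ (inj₁ (refl , e∉clS)))) → flat-A∪a flat e∉clS
  ; (inj₂ (inj₂ (inj₂ (inj₁ (refl , e∉clS , _ , noOX , _ , no𝓣))))) → flat-A∪γ flat noOX e∉clS no𝓣
  ; (inj₂ (inj₂ (inj₂ (inj₂ (inj₁ (refl , noClOX , e∉clS , no𝓣)))))) →
      flat-A∪γ flat (noClOX ∘ ContainsOX⇒ClContainsOX) e∉clS no𝓣
  ; (inj₂ (inj₂ (inj₂ (inj₂ (inj₂ (refl , e∈S)))))) → flat-A∪aγ flat e∈S
  }
  where open EsSplitting AM X e e∈X
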